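{- For every test-free limit-matching rPrompt-LDL formula $\varphi$ and every $\beta \in \mathbb{B}_4$, there is a Prompt-LDL formula $\varphi_\beta$ such that $V_{\mathrm{rPromptLDL}}(w, k, \varphi) \succeq \beta$ if and only if $V_{\mathrm{PromptLDL}}(w, k, \varphi_\beta) = 1$ (for every trace $w$ and every bound $k\in\mathbb{N}$).
   Context: Fix a finite set $P$ of atomic propositions; traces are $w\in(2^P)^\omega$. Truth values for robust semantics are $\mathbb{B}_4=\{0000,0001,0011,0111,1111\}$ ordered $0000\prec 0001\prec 0011\prec 0111\prec 1111$. rPrompt-LDL formulas are given by $\varphi ::= p \mid \neg p \mid \varphi\wedge\varphi \mid \varphi\vee\varphi \mid \langle r\rangle^{\cdot}\varphi \mid [r]^{\cdot}\varphi \mid \langle r\rangle^{\cdot}_{\mathbf{p}}\varphi$ with guards $r ::= \phi \mid \varphi? \mid r+r \mid r\,;r \mid r^*$ (negation only on atoms, no implication). Their semantics is an evaluation function $V_{\mathrm{rPromptLDL}}(w,k,\varphi)\in\mathbb{B}_4$ depending on a bound $k$: it is the robust (five-valued) semantics of robust LDL (robust diamond = bitwise maximum over $r$-matches; robust box with bits meaning "all / almost all / infinitely many / some $r$-matches satisfy $\varphi$", with special cases for finitely many or no matches), extended by the prompt diamond $\langle r\rangle^{\cdot}_{\mathbf{p}}\varphi$, which maximizes only over $r$-matches at positions $0,\dots,k$. Prompt-LDL is the Boolean-valued logic with the same (negation-normal-form) syntax and operators $\langle r\rangle$, $[r]$, $\langle r\rangle_{\mathbf{p}}$, with evaluation function $V_{\mathrm{PromptLDL}}(w,k,\varphi)\in\{0,1\}$,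 where $\langle r\rangle_{\mathbf{p}}\varphi$ requires a $\varphi$-satisfying $r$-match within the first $k$ positions. A guard is test-free if it contains no tests $\varphi?$ (only propositional formulas as atoms); for test-free $r$ the set $\mathcal{R}(w,r)$ of positions $j$ such that $w(0)\cdots w(j-1)$ matches $r$ is independent of the bit index and of $k$. A test-free guard $r$ is limit-matching if $\mathcal{R}(w,r)$ is infinite for every trace $w$. A formula is test-free (resp. limit-matching) if all its guards are. -}

module Defs where

open import Data.Nat using (ℕ; zero; suc; _+_; _≤_; _<_)
open import Data.Fin using (Fin; zero; suc)
open import Data.Fin.Subset using (Subset; _∈_; _∉_)
open import Data.Vec using (lookup)
open import Data.Bool using (Bool; true; false; _∧_; _∨_; not; T)
open import Data.Product using (Σ; ∃; _×_; _,_)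
open import Data.Sum using (_⊎_)
open import Data.Empty using (⊥)
open import Data.Unit using (⊤)
open import Relation.Binary.PropositionalEquality using (_≡_)
open import Relation.Binary.Construct.Closure.ReflexiveTransitive using (Star)

Trace : ℕ → Set
Trace n = ℕ → Subset n

data PropF (n : ℕ) : Set where
  ptrue  : PropF n
  patom  : Fin n → PropF n
  pnot   : PropF n → PropF n
  pand   : PropF n → PropF n → PropF n
  por    : PropF n → PropF n → PropF n

evalP : ∀ {n} → Subset n → PropF n → Bool
evalP s ptrue       = true
evalP s (patom p)   = lookup s p
evalP s (pnot ψ)    = not (evalP s ψ)
evalP s (pand ψ χ)  = evalP s ψ ∧ evalP s χ
evalP s (por ψ χ)   = evalP s ψ ∨ evalP s χ

-- Syntax (negation normal form).  rPrompt-LDL and Prompt-LDL share the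
-- same syntax; they differ only in their semantics.
--   ⟨r⟩φ = dia r φ,  [r]φ = box r φ,  ⟨r⟩_p φ = pdia r φ.

mutual
  data Form (n : ℕ) : Set where
    atom   : Fin n → Form n
    natom  : Fin n → Form n
    _∧ᶠ_   : Form n → Form n → Form n
    _∨ᶠ_   : Form n → Form n → Form n
    dia    : Guard n → Form n → Form n
    box    : Guard n → Form n → Form n
    pdia   : Guard n → Form n → Form n

  data Guard (n : ℕ) : Set where
    gprop  : PropF n → Guard n
    gtest  : Form n → Guard n
    _+ᵍ_   : Guard n → Guard n → Guard n
    _·ᵍ_   : Guard n → Guard n → Guard n
    gstar  : Guard n → Guard n

Infinite : (ℕ → Set) → Set
Infinite M = ∀ m → ∃ λ j → m ≤ j × M j

Finite : (ℕ → Set) → Set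
Finite M = ∃ λ b → ∀ j → M j → j < b

-- Bit indices (Fin 4): zero = first bit ("all"), …, 3 = last bit ("some").
-- A value b₀b₁b₂b₃ ∈ 𝔹₄; RHolds ℓ w k φ i  ⇔  bit ℓ of V(w[i..], k, φ) is 1.
-- Positions are absolute; the suffix w[i..] is evaluated at position i.
-- RMatch ℓ w k r i j ⇔ w(i)…w(j-1) matches r (tests evaluated at bit ℓ).

BoxInf : Fin 4 → (ℕ → Set) → (ℕ → Set) → Set
BoxInf zero                   M S = ∀ j → M j → S j
BoxInf (suc zero)             M S = ∃ λ m → ∀ j → m ≤ j → M j → S j
BoxInf (suc (suc zero))       M S = ∀ m → ∃ λ j → m ≤ j × M j × S j
BoxInf (suc (suc (suc zero))) M S = ∃ λ j → M j × S j

mutual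
  RHolds : ∀ {n} → Fin 4 → Trace n → ℕ → Form n → ℕ → Set
  RHolds ℓ w k (atom p)   i = p ∈ w i
  RHolds ℓ w k (natom p)  i = p ∉ w i
  RHolds ℓ w k (φ ∧ᶠ ψ)   i = RHolds ℓ w k φ i × RHolds ℓ w k ψ i
  RHolds ℓ w k (φ ∨ᶠ ψ)   i = RHolds ℓ w k φ i ⊎ RHolds ℓ w k ψ i
  RHolds ℓ w k (dia r φ)  i = ∃ λ j → RMatch ℓ w k r i j × RHolds ℓ w k φ j
  RHolds ℓ w k (pdia r φ) i = ∃ λ j → j ≤ i + k × RMatch ℓ w k r i j × RHolds ℓ w k φ j
  RHolds ℓ w k (box r φ)  i =
      (Infinite (RMatch ℓ w k r i) → BoxInf ℓ (RMatch ℓ w k r i) (RHolds ℓ w k φ))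
    × (Finite (RMatch ℓ w k r i) → ∀ j → RMatch ℓ w k r i j → RHolds ℓ w k φ j)

  RMatch : ∀ {n} → Fin 4 → Trace n → ℕ → Guard n → ℕ → ℕ → Set
  RMatch ℓ w k (gprop ψ) i j = j ≡ suc i × T (evalP (w i) ψ)
  RMatch ℓ w k (gtest φ) i j = j ≡ i × RHolds ℓ w k φ i
  RMatch ℓ w k (r +ᵍ s)  i j = RMatch ℓ w k r i j ⊎ RMatch ℓ w k s i j
  RMatch ℓ w k (r ·ᵍ s)  i j = ∃ λ m → RMatch ℓ w k r i m × RMatch ℓ w k s m j
  RMatch ℓ w k (gstar r) i j = Star (RMatch ℓ w k r) i j

data 𝔹₄ : Set where
  b0000 b0001 b0011 b0111 b1111 : 𝔹₄

bit : 𝔹₄ → Fin 4 → Bool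
bit b0000 _ = false
bit b0001 (suc (suc (suc zero))) = true
bit b0001 _ = false
bit b0011 zero = false
bit b0011 (suc zero) = false
bit b0011 _ = true
bit b0111 zero = false
bit b0111 _ = true
bit b1111 _ = true

-- V_rPromptLDL(w, k, φ) ⪰ β : on 𝔹₄ the order ⪯ coincides with the
-- bitwise order, so this says every bit set in β is set in V(w,k,φ).
RGeq : ∀ {n} → Trace n → ℕ → Form n → 𝔹₄ → Set
RGeq w k φ β = ∀ ℓ → T (bit β ℓ) → RHolds ℓ w k φ 0

mutual
  PHolds : ∀ {n} → Trace n → ℕ → Form n → ℕ → Set
  PHolds w k (atom p)   i = p ∈ w i
  PHolds w k (natom p)  i = p ∉ w i
  PHolds w k (φ ∧ᶠ ψ)   i = PHolds w k φ i × PHolds w k ψ i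
  PHolds w k (φ ∨ᶠ ψ)   i = PHolds w k φ i ⊎ PHolds w k ψ i
  PHolds w k (dia r φ)  i = ∃ λ j → PMatch w k r i j × PHolds w k φ j
  PHolds w k (pdia r φ) i = ∃ λ j → j ≤ i + k × PMatch w k r i j × PHolds w k φ j
  PHolds w k (box r φ)  i = ∀ j → PMatch w k r i j → PHolds w k φ j

  PMatch : ∀ {n} → Trace n → ℕ → Guard n → ℕ → ℕ → Set
  PMatch w k (gprop ψ) i j = j ≡ suc i × T (evalP (w i) ψ)
  PMatch w k (gtest φ) i j = j ≡ i × PHolds w k φ i
  PMatch w k (r +ᵍ s)  i j = PMatch w k r i j ⊎ PMatch w k s i j
  PMatch w k (r ·ᵍ s)  i j = ∃ λ m → PMatch w k r i m × PMatch w k s m j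
  PMatch w k (gstar r) i j = Star (PMatch w k r) i j

PSat : ∀ {n} → Trace n → ℕ → Form n → Set
PSat w k φ = PHolds w k φ 0

TestFreeG : ∀ {n} → Guard n → Set
TestFreeG (gprop ψ) = ⊤
TestFreeG (gtest φ) = ⊥
TestFreeG (r +ᵍ s)  = TestFreeG r × TestFreeG s
TestFreeG (r ·ᵍ s)  = TestFreeG r × TestFreeG s
TestFreeG (gstar r) = TestFreeG r

TFMatch : ∀ {n} → Trace n → Guard n → ℕ → ℕ → Set
TFMatch w (gprop ψ) i j = j ≡ suc i × T (evalP (w i) ψ)
TFMatch w (gtest φ) i j = ⊥
TFMatch w (r +ᵍ s)  i j = TFMatch w r i j ⊎ TFMatch w s i j
TFMatch w (r ·ᵍ s)  i j = ∃ λ m → TFMatch w r i m × TFMatch w s m j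
TFMatch w (gstar r) i j = Star (TFMatch w r) i j

𝓡 : ∀ {n} → Trace n → Guard n → ℕ → Set
𝓡 w r j = TFMatch w r 0 j

LimitMatchingG : ∀ {n} → Guard n → Set
LimitMatchingG r = TestFreeG r × (∀ w → Infinite (𝓡 w r))

mutual
  AllGuards : ∀ {n} → (Guard n → Set) → Form n → Set
  AllGuards G (atom p)   = ⊤
  AllGuards G (natom p)  = ⊤
  AllGuards G (φ ∧ᶠ ψ)   = AllGuards G φ × AllGuards G ψ
  AllGuards G (φ ∨ᶠ ψ)   = AllGuards G φ × AllGuards G ψ
  AllGuards G (dia r φ)  = G r × AllGuardsG G r × AllGuards G φ
  AllGuards G (box r φ)  = G r × AllGuardsG G r × AllGuards G φ
  AllGuards G (pdia r φ) = G r × AllGuardsG G r × AllGuards G φ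

  AllGuardsG : ∀ {n} → (Guard n → Set) → Guard n → Set
  AllGuardsG G (gprop ψ) = ⊤
  AllGuardsG G (gtest φ) = AllGuards G φ
  AllGuardsG G (r +ᵍ s)  = AllGuardsG G r × AllGuardsG G s
  AllGuardsG G (r ·ᵍ s)  = AllGuardsG G r × AllGuardsG G s
  AllGuardsG G (gstar r) = AllGuardsG G r

TestFree : ∀ {n} → Form n → Set
TestFree = AllGuards TestFreeG

LimitMatching : ∀ {n} → Form n → Set
LimitMatching = AllGuards LimitMatchingG

module Submission where

-- For a limit-matching guard r every position has infinitely many r-matches, so the clause of
-- the robust box for finitely many matches is vacuous and its four bits say that all, almost
-- all, infinitely many, or some r-matches satisfy φ. The first and last are the Boolean [r]φ
-- and ⟨r⟩φ. For the other two, run a deterministic automaton for r (the subset construction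
-- on the Glushkov automaton) from the current position: the state q reached at a cut point m
-- determines which extensions beyond m are r-matches. Kleene's construction gives guards
-- reach q (the words leading to q) and toAccepting q (the words leading from q to acceptance),
-- and then "almost all" is ⋁_q ⟨reach q⟩[toAccepting q]φ while "infinitely many" is
-- ⋀_q [reach q]⟨toAccepting q⟩φ. Translating bitwise and conjoining the bits set in β gives φ_β.

open import Defs
open import Data.Nat using (ℕ; zero; suc; _+_; _≤_; _<_; s≤s; _⊔_)
open import Data.Nat.Properties
  using ( ≤-refl; ≤-trans; n≤1+n; <-irrefl; ≤⇒≯; m+1+n≢m; +-suc; +-identityʳ; +-assoc; +-comm
        ; m≤n+m; m≤m⊔n; m≤n⊔m; m≤n⇒∃[o]m+o≡n)
open import Data.Fin using (Fin; zero; suc)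
open import Data.Fin.Subset using (Subset)
open import Data.Bool using (Bool; true; false; _∧_; _∨_; T; if_then_else_)
open import Data.Bool.Properties using (T-∧; T-∨; T-≡; T-not-≡)
open import Data.Product as Product using (∃; _×_; _,_; proj₁; proj₂)
open import Data.Product.Properties using (×-≡,≡→≡; ×-≡,≡←≡)
open import Data.Product.Function.NonDependent.Propositional using (_×-⇔_)
open import Data.Sum as Sum using (_⊎_; inj₁; inj₂)
open import Data.Sum.Function.Propositional using (_⊎-⇔_)
open import Data.Empty using (⊥; ⊥-elim)
open import Data.Unit using (⊤; tt)
open import Data.List using (List; []; _∷_; cartesianProduct)
open import Data.List.Membership.Propositional using (_∈_)
open import Data.List.Membership.Propositional.Properties using (∈-cartesianProduct⁺)
open import Data.List.Relation.Unary.Any using (here; there)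
open import Relation.Nullary using (¬_)
open import Relation.Binary.PropositionalEquality using (_≡_; refl; sym; cong; subst)
open import Relation.Binary.Construct.Closure.ReflexiveTransitive using (Star; ε; _◅_; _◅◅_)
  renaming (map to Star-map)
open import Function.Base using (_∘_)
open import Function.Bundles using (_⇔_; mk⇔; Equivalence)
open import Function.Construct.Identity using (⇔-id)
open import Function.Construct.Composition using (_⇔-∘_)
open import Function.Construct.Symmetry using (⇔-sym)
open Equivalence using (to; from)

∃-⊎⇔ : ∀ {A B : Set} {P : A ⊎ B → Set} → ∃ P ⇔ (∃ (P ∘ inj₁) ⊎ ∃ (P ∘ inj₂))
∃-⊎⇔ = mk⇔ (λ { (inj₁ a , h) → inj₁ (a , h) ; (inj₂ b , h) → inj₂ (b , h) })
            (λ { (inj₁ (a , h)) → inj₁ a , h ; (inj₂ (b , h)) → inj₂ b , h })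

∃-inj₁⇔ : ∀ {A B : Set} {P : A ⊎ B → Set} → (∀ b → ¬ P (inj₂ b)) → ∃ (P ∘ inj₁) ⇔ ∃ P
∃-inj₁⇔ ¬P₂ = mk⇔ (λ (a , h) → inj₁ a , h)
                   λ { (inj₁ a , h) → a , h ; (inj₂ b , h) → ⊥-elim (¬P₂ b h) }

∃-inj₂⇔ : ∀ {A B : Set} {P : A ⊎ B → Set} → (∀ a → ¬ P (inj₁ a)) → ∃ (P ∘ inj₂) ⇔ ∃ P
∃-inj₂⇔ ¬P₁ = mk⇔ (λ (b , h) → inj₂ b , h)
                   λ { (inj₂ b , h) → b , h ; (inj₁ a , h) → ⊥-elim (¬P₁ a h) }

-- Test-free matching

⊥ᵖ : ∀ {n} → PropF n
⊥ᵖ = pnot ptrue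

∅ᵍ : ∀ {n} → Guard n
∅ᵍ = gprop ⊥ᵖ

εᵍ : ∀ {n} → Guard n
εᵍ = gstar ∅ᵍ

_onlyIf_ : ∀ {n} → Guard n → Bool → Guard n
g onlyIf b = if b then g else ∅ᵍ

onlyIf-testFree : ∀ {n} {g : Guard n} b → TestFreeG g → TestFreeG (g onlyIf b)
onlyIf-testFree true tf = tf
onlyIf-testFree false _ = tt

module _ {n : ℕ} (w : Trace n) (k : ℕ) where

  RMatch⇔TFMatch : ∀ ℓ (r : Guard n) → TestFreeG r → ∀ {i j} →
                   RMatch ℓ w k r i j ⇔ TFMatch w r i j
  RMatch⇔TFMatch ℓ (gprop ψ) _ = ⇔-id _
  RMatch⇔TFMatch ℓ (r +ᵍ s) (tf-r , tf-s) =
    RMatch⇔TFMatch ℓ r tf-r ⊎-⇔ RMatch⇔TFMatch ℓ s tf-s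
  RMatch⇔TFMatch ℓ (r ·ᵍ s) (tf-r , tf-s) = mk⇔
    (λ (m , x , y) → m , to (RMatch⇔TFMatch ℓ r tf-r) x , to (RMatch⇔TFMatch ℓ s tf-s) y)
    (λ (m , x , y) → m , from (RMatch⇔TFMatch ℓ r tf-r) x , from (RMatch⇔TFMatch ℓ s tf-s) y)
  RMatch⇔TFMatch ℓ (gstar r) tf-r =
    mk⇔ (Star-map (to (RMatch⇔TFMatch ℓ r tf-r))) (Star-map (from (RMatch⇔TFMatch ℓ r tf-r)))

  PMatch⇔TFMatch : ∀ (r : Guard n) → TestFreeG r → ∀ {i j} → PMatch w k r i j ⇔ TFMatch w r i j
  PMatch⇔TFMatch (gprop ψ) _ = ⇔-id _
  PMatch⇔TFMatch (r +ᵍ s) (tf-r , tf-s) = PMatch⇔TFMatch r tf-r ⊎-⇔ PMatch⇔TFMatch s tf-s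
  PMatch⇔TFMatch (r ·ᵍ s) (tf-r , tf-s) = mk⇔
    (λ (m , x , y) → m , to (PMatch⇔TFMatch r tf-r) x , to (PMatch⇔TFMatch s tf-s) y)
    (λ (m , x , y) → m , from (PMatch⇔TFMatch r tf-r) x , from (PMatch⇔TFMatch s tf-s) y)
  PMatch⇔TFMatch (gstar r) tf-r =
    mk⇔ (Star-map (to (PMatch⇔TFMatch r tf-r))) (Star-map (from (PMatch⇔TFMatch r tf-r)))

  RMatch⇔PMatch : ∀ ℓ (r : Guard n) → TestFreeG r → ∀ {i j} → RMatch ℓ w k r i j ⇔ PMatch w k r i j
  RMatch⇔PMatch ℓ r tf {i} {j} = ⇔-sym (PMatch⇔TFMatch r tf) ⇔-∘ RMatch⇔TFMatch ℓ r tf {i} {j}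

module _ {n : ℕ} (w : Trace n) where

  TFMatch⇒≤ : ∀ (r : Guard n) {i j} → TFMatch w r i j → i ≤ j
  TFMatch⇒≤ (gprop ψ) (refl , _) = n≤1+n _
  TFMatch⇒≤ (r +ᵍ s) (inj₁ x) = TFMatch⇒≤ r x
  TFMatch⇒≤ (r +ᵍ s) (inj₂ y) = TFMatch⇒≤ s y
  TFMatch⇒≤ (r ·ᵍ s) (m , x , y) = ≤-trans (TFMatch⇒≤ r x) (TFMatch⇒≤ s y)
  TFMatch⇒≤ (gstar r) ε = ≤-refl
  TFMatch⇒≤ (gstar r) (x ◅ xs) = ≤-trans (TFMatch⇒≤ r x) (TFMatch⇒≤ (gstar r) xs)

  TFMatch-shift : ∀ i (r : Guard n) {a b} →
                  TFMatch (λ t → w (i + t)) r a b → TFMatch w r (i + a) (i + b)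
  TFMatch-shift i (gprop ψ) {a} (refl , h) = +-suc i a , h
  TFMatch-shift i (r +ᵍ s) (inj₁ x) = inj₁ (TFMatch-shift i r x)
  TFMatch-shift i (r +ᵍ s) (inj₂ y) = inj₂ (TFMatch-shift i s y)
  TFMatch-shift i (r ·ᵍ s) (m , x , y) = i + m , TFMatch-shift i r x , TFMatch-shift i s y
  TFMatch-shift i (gstar r) ε = ε
  TFMatch-shift i (gstar r) (x ◅ xs) = TFMatch-shift i r x ◅ TFMatch-shift i (gstar r) xs

  limitMatching⇒infinite : ∀ {r : Guard n} → LimitMatchingG r → ∀ i → Infinite (TFMatch w r i)
  limitMatching⇒infinite {r} (_ , inf) i m =
    let j , m≤j , x = inf (λ t → w (i + t)) m
    in i + j , ≤-trans m≤j (m≤n+m j i) ,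
       subst (λ a → TFMatch w r a (i + j)) (+-identityʳ i) (TFMatch-shift i r x)

  onlyIf⇔ : ∀ (g : Guard n) b {i j} → TFMatch w (g onlyIf b) i j ⇔ (T b × TFMatch w g i j)
  onlyIf⇔ g true = mk⇔ (tt ,_) proj₂
  onlyIf⇔ g false = mk⇔ (λ ()) λ ()

-- Glushkov positions

module Glushkov {n : ℕ} where

  Position : Guard n → Set
  Position (gprop ψ) = ⊤
  Position (gtest φ) = ⊥
  Position (r +ᵍ s) = Position r ⊎ Position s
  Position (r ·ᵍ s) = Position r ⊎ Position s
  Position (gstar r) = Position r

  -- Sets of positions are Boolean trees rather than predicates, so that states of the subset
  -- automaton have an intensional equality that a propositional formula (restrictsTo) can test.
  PositionSet : Guard n → Set
  PositionSet (gprop ψ) = Bool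
  PositionSet (gtest φ) = ⊤
  PositionSet (r +ᵍ s) = PositionSet r × PositionSet s
  PositionSet (r ·ᵍ s) = PositionSet r × PositionSet s
  PositionSet (gstar r) = PositionSet r

  member : (r : Guard n) → PositionSet r → Position r → Bool
  member (gprop ψ) b _ = b
  member (r +ᵍ s) (X , _) (inj₁ p) = member r X p
  member (r +ᵍ s) (_ , Y) (inj₂ q) = member s Y q
  member (r ·ᵍ s) (X , _) (inj₁ p) = member r X p
  member (r ·ᵍ s) (_ , Y) (inj₂ q) = member s Y q
  member (gstar r) X p = member r X p

  label : (r : Guard n) → Position r → PropF n
  label (gprop ψ) _ = ψ
  label (r +ᵍ s) (inj₁ p) = label r p
  label (r +ᵍ s) (inj₂ q) = label s q
  label (r ·ᵍ s) (inj₁ p) = label r p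
  label (r ·ᵍ s) (inj₂ q) = label s q
  label (gstar r) p = label r p

  empty : (r : Guard n) → PositionSet r
  empty (gprop ψ) = false
  empty (gtest φ) = tt
  empty (r +ᵍ s) = empty r , empty s
  empty (r ·ᵍ s) = empty r , empty s
  empty (gstar r) = empty r

  union : (r : Guard n) → PositionSet r → PositionSet r → PositionSet r
  union (gprop ψ) a b = a ∨ b
  union (gtest φ) _ _ = tt
  union (r +ᵍ s) (X , Y) (X′ , Y′) = union r X X′ , union s Y Y′
  union (r ·ᵍ s) (X , Y) (X′ , Y′) = union r X X′ , union s Y Y′
  union (gstar r) X X′ = union r X X′

  when : (r : Guard n) → Bool → PositionSet r → PositionSet r
  when r b X = if b then X else empty r

  restrict : (r : Guard n) → PositionSet r → Subset n → PositionSet r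
  restrict (gprop ψ) a x = a ∧ evalP x ψ
  restrict (gtest φ) _ _ = tt
  restrict (r +ᵍ s) (X , Y) x = restrict r X x , restrict s Y x
  restrict (r ·ᵍ s) (X , Y) x = restrict r X x , restrict s Y x
  restrict (gstar r) X x = restrict r X x

  meets : (r : Guard n) → PositionSet r → PositionSet r → Bool
  meets (gprop ψ) a b = a ∧ b
  meets (gtest φ) _ _ = false
  meets (r +ᵍ s) (X , Y) (X′ , Y′) = meets r X X′ ∨ meets s Y Y′
  meets (r ·ᵍ s) (X , Y) (X′ , Y′) = meets r X X′ ∨ meets s Y Y′
  meets (gstar r) X X′ = meets r X X′

  nullable : Guard n → Bool
  nullable (gprop ψ) = false
  nullable (gtest φ) = false
  nullable (r +ᵍ s) = nullable r ∨ nullable s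
  nullable (r ·ᵍ s) = nullable r ∧ nullable s
  nullable (gstar r) = true

  first : (r : Guard n) → PositionSet r
  first (gprop ψ) = true
  first (gtest φ) = tt
  first (r +ᵍ s) = first r , first s
  first (r ·ᵍ s) = first r , when s (nullable r) (first s)
  first (gstar r) = first r

  last : (r : Guard n) → PositionSet r
  last (gprop ψ) = true
  last (gtest φ) = tt
  last (r +ᵍ s) = last r , last s
  last (r ·ᵍ s) = when r (nullable s) (last r) , last s
  last (gstar r) = last r

  Member : (r : Guard n) → PositionSet r → Position r → Set
  Member r X p = T (member r X p)

  Follows : (r : Guard n) → Position r → Position r → Set
  Follows (gprop ψ) _ _ = ⊥
  Follows (r +ᵍ s) (inj₁ p) (inj₁ q) = Follows r p q
  Follows (r +ᵍ s) (inj₂ p) (inj₂ q) = Follows s p q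
  Follows (r +ᵍ s) _ _ = ⊥
  Follows (r ·ᵍ s) (inj₁ p) (inj₁ q) = Follows r p q
  Follows (r ·ᵍ s) (inj₁ p) (inj₂ q) = Member r (last r) p × Member s (first s) q
  Follows (r ·ᵍ s) (inj₂ p) (inj₁ q) = ⊥
  Follows (r ·ᵍ s) (inj₂ p) (inj₂ q) = Follows s p q
  Follows (gstar r) p q = Follows r p q ⊎ (Member r (last r) p × Member r (first r) q)

  successors : (r : Guard n) → PositionSet r → PositionSet r
  successors (gprop ψ) _ = false
  successors (gtest φ) _ = tt
  successors (r +ᵍ s) (X , Y) = successors r X , successors s Y
  successors (r ·ᵍ s) (X , Y) =
    successors r X , union s (successors s Y) (when s (meets r X (last r)) (first s))
  successors (gstar r) X = union r (successors r X) (when r (meets r X (last r)) (first r))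

  ∉-empty : (r : Guard n) (p : Position r) → ¬ Member r (empty r) p
  ∉-empty (gprop ψ) _ ()
  ∉-empty (r +ᵍ s) (inj₁ p) = ∉-empty r p
  ∉-empty (r +ᵍ s) (inj₂ q) = ∉-empty s q
  ∉-empty (r ·ᵍ s) (inj₁ p) = ∉-empty r p
  ∉-empty (r ·ᵍ s) (inj₂ q) = ∉-empty s q
  ∉-empty (gstar r) p = ∉-empty r p

  ∈-union : (r : Guard n) (X Y : PositionSet r) (p : Position r) →
            Member r (union r X Y) p ⇔ (Member r X p ⊎ Member r Y p)
  ∈-union (gprop ψ) a b _ = T-∨
  ∈-union (r +ᵍ s) (X , Y) (X′ , Y′) (inj₁ p) = ∈-union r X X′ p
  ∈-union (r +ᵍ s) (X , Y) (X′ , Y′) (inj₂ q) = ∈-union s Y Y′ q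
  ∈-union (r ·ᵍ s) (X , Y) (X′ , Y′) (inj₁ p) = ∈-union r X X′ p
  ∈-union (r ·ᵍ s) (X , Y) (X′ , Y′) (inj₂ q) = ∈-union s Y Y′ q
  ∈-union (gstar r) X X′ p = ∈-union r X X′ p

  ∈-when : (r : Guard n) (b : Bool) (X : PositionSet r) (p : Position r) →
           Member r (when r b X) p ⇔ (T b × Member r X p)
  ∈-when r true X p = mk⇔ (tt ,_) proj₂
  ∈-when r false X p = mk⇔ (⊥-elim ∘ ∉-empty r p) λ ()

  ∈-restrict : (r : Guard n) (X : PositionSet r) (x : Subset n) (p : Position r) →
               Member r (restrict r X x) p ⇔ (Member r X p × T (evalP x (label r p)))
  ∈-restrict (gprop ψ) a x _ = T-∧
  ∈-restrict (r +ᵍ s) (X , Y) x (inj₁ p) = ∈-restrict r X x p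
  ∈-restrict (r +ᵍ s) (X , Y) x (inj₂ q) = ∈-restrict s Y x q
  ∈-restrict (r ·ᵍ s) (X , Y) x (inj₁ p) = ∈-restrict r X x p
  ∈-restrict (r ·ᵍ s) (X , Y) x (inj₂ q) = ∈-restrict s Y x q
  ∈-restrict (gstar r) X x p = ∈-restrict r X x p

  meets⇔ : (r : Guard n) (X Y : PositionSet r) →
           T (meets r X Y) ⇔ ∃ λ p → Member r X p × Member r Y p
  meets⇔ (gprop ψ) a b = mk⇔ (tt ,_) proj₂ ⇔-∘ T-∧
  meets⇔ (gtest φ) _ _ = mk⇔ (λ ()) λ ()
  meets⇔ (r +ᵍ s) (X , Y) (X′ , Y′) =
    ⇔-sym ∃-⊎⇔ ⇔-∘ ((meets⇔ r X X′ ⊎-⇔ meets⇔ s Y Y′) ⇔-∘ T-∨)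
  meets⇔ (r ·ᵍ s) (X , Y) (X′ , Y′) =
    ⇔-sym ∃-⊎⇔ ⇔-∘ ((meets⇔ r X X′ ⊎-⇔ meets⇔ s Y Y′) ⇔-∘ T-∨)
  meets⇔ (gstar r) X X′ = meets⇔ r X X′

  ∈-union-when-meets : (r r′ : Guard n) (A F : PositionSet r) (X L : PositionSet r′)
                       (q : Position r) →
    Member r (union r A (when r (meets r′ X L) F)) q ⇔
    (Member r A q ⊎ ((∃ λ p → Member r′ X p × Member r′ L p) × Member r F q))
  ∈-union-when-meets r r′ A F X L q =
    (⇔-id _ ⊎-⇔ ((meets⇔ r′ X L ×-⇔ ⇔-id _) ⇔-∘ ∈-when r _ F q)) ⇔-∘ ∈-union r A _ q

  ∈-successors : (r : Guard n) (X : PositionSet r) (q : Position r) →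
                 Member r (successors r X) q ⇔ ∃ λ p → Member r X p × Follows r p q
  ∈-successors (gprop ψ) _ _ = mk⇔ (λ ()) λ ()
  ∈-successors (r +ᵍ s) (X , Y) (inj₁ q) = ∃-inj₁⇔ (λ _ ()) ⇔-∘ ∈-successors r X q
  ∈-successors (r +ᵍ s) (X , Y) (inj₂ q) = ∃-inj₂⇔ (λ _ ()) ⇔-∘ ∈-successors s Y q
  ∈-successors (r ·ᵍ s) (X , Y) (inj₁ q) = ∃-inj₁⇔ (λ _ ()) ⇔-∘ ∈-successors r X q
  ∈-successors (r ·ᵍ s) (X , Y) (inj₂ q) =
    ⇔-sym ∃-⊎⇔ ⇔-∘
      (mk⇔ (λ { (inj₁ h) → inj₂ (to (∈-successors s Y q) h)
              ; (inj₂ ((p , x , l) , f)) → inj₁ (p , x , l , f) })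
           (λ { (inj₂ h) → inj₁ (from (∈-successors s Y q) h)
              ; (inj₁ (p , x , l , f)) → inj₂ ((p , x , l) , f) })
       ⇔-∘ ∈-union-when-meets s r _ (first s) X (last r) q)
  ∈-successors (gstar r) X q =
    mk⇔ (λ { (inj₁ h) → let p , x , f = to (∈-successors r X q) h in p , x , inj₁ f
           ; (inj₂ ((p , x , l) , f)) → p , x , inj₂ (l , f) })
        (λ { (p , x , inj₁ f) → inj₁ (from (∈-successors r X q) (p , x , f))
           ; (p , x , inj₂ (l , f)) → inj₂ ((p , x , l) , f) })
    ⇔-∘ ∈-union-when-meets r r _ (first r) X (last r) q

  restrictsTo : (r : Guard n) → PositionSet r → PositionSet r → PropF n
  restrictsTo (gprop ψ) true true = ψ
  restrictsTo (gprop ψ) true false = pnot ψ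
  restrictsTo (gprop ψ) false true = ⊥ᵖ
  restrictsTo (gprop ψ) false false = ptrue
  restrictsTo (gtest φ) _ _ = ptrue
  restrictsTo (r +ᵍ s) (X , Y) (X′ , Y′) = pand (restrictsTo r X X′) (restrictsTo s Y Y′)
  restrictsTo (r ·ᵍ s) (X , Y) (X′ , Y′) = pand (restrictsTo r X X′) (restrictsTo s Y Y′)
  restrictsTo (gstar r) X X′ = restrictsTo r X X′

  restrictsTo⇔ : (r : Guard n) (X Y : PositionSet r) (x : Subset n) →
                 T (evalP x (restrictsTo r X Y)) ⇔ (restrict r X x ≡ Y)
  restrictsTo⇔ (gprop ψ) true true x = T-≡
  restrictsTo⇔ (gprop ψ) true false x = T-not-≡
  restrictsTo⇔ (gprop ψ) false true x = mk⇔ (λ ()) λ ()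
  restrictsTo⇔ (gprop ψ) false false x = mk⇔ (λ _ → refl) (λ _ → tt)
  restrictsTo⇔ (gtest φ) _ _ x = mk⇔ (λ _ → refl) (λ _ → tt)
  restrictsTo⇔ (r +ᵍ s) (X , Y) (X′ , Y′) x =
    mk⇔ ×-≡,≡→≡ ×-≡,≡←≡ ⇔-∘
    ((restrictsTo⇔ r X X′ x ×-⇔ restrictsTo⇔ s Y Y′ x) ⇔-∘ T-∧)
  restrictsTo⇔ (r ·ᵍ s) (X , Y) (X′ , Y′) x =
    mk⇔ ×-≡,≡→≡ ×-≡,≡←≡ ⇔-∘
    ((restrictsTo⇔ r X X′ x ×-⇔ restrictsTo⇔ s Y Y′ x) ⇔-∘ T-∧)
  restrictsTo⇔ (gstar r) X X′ x = restrictsTo⇔ r X X′ x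

  positionSets : (r : Guard n) → List (PositionSet r)
  positionSets (gprop ψ) = true ∷ false ∷ []
  positionSets (gtest φ) = tt ∷ []
  positionSets (r +ᵍ s) = cartesianProduct (positionSets r) (positionSets s)
  positionSets (r ·ᵍ s) = cartesianProduct (positionSets r) (positionSets s)
  positionSets (gstar r) = positionSets r

  ∈-positionSets : (r : Guard n) (X : PositionSet r) → X ∈ positionSets r
  ∈-positionSets (gprop ψ) true = here refl
  ∈-positionSets (gprop ψ) false = there (here refl)
  ∈-positionSets (gtest φ) tt = here refl
  ∈-positionSets (r +ᵍ s) (X , Y) =
    ∈-cartesianProduct⁺ (∈-positionSets r X) (∈-positionSets s Y)
  ∈-positionSets (r ·ᵍ s) (X , Y) =
    ∈-cartesianProduct⁺ (∈-positionSets r X) (∈-positionSets s Y)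
  ∈-positionSets (gstar r) X = ∈-positionSets r X

module GlushkovMatching {n : ℕ} (w : Trace n) where
  open Glushkov

  emptyMatch⇒nullable : ∀ (r : Guard n) {i j} → TFMatch w r i j → j ≤ i → T (nullable r)
  emptyMatch⇒nullable (gprop ψ) (refl , _) j≤i = ⊥-elim (<-irrefl refl j≤i)
  emptyMatch⇒nullable (r +ᵍ s) (inj₁ x) j≤i = from T-∨ (inj₁ (emptyMatch⇒nullable r x j≤i))
  emptyMatch⇒nullable (r +ᵍ s) (inj₂ y) j≤i = from T-∨ (inj₂ (emptyMatch⇒nullable s y j≤i))
  emptyMatch⇒nullable (r ·ᵍ s) (m , x , y) j≤i = from T-∧
    ( emptyMatch⇒nullable r x (≤-trans (TFMatch⇒≤ w s y) j≤i)
    , emptyMatch⇒nullable s y (≤-trans j≤i (TFMatch⇒≤ w r x)))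
  emptyMatch⇒nullable (gstar r) _ _ = tt

  nullable⇒emptyMatch : ∀ (r : Guard n) {i} → T (nullable r) → TFMatch w r i i
  nullable⇒emptyMatch (r +ᵍ s) h with to T-∨ h
  ... | inj₁ hr = inj₁ (nullable⇒emptyMatch r hr)
  ... | inj₂ hs = inj₂ (nullable⇒emptyMatch s hs)
  nullable⇒emptyMatch (r ·ᵍ s) h =
    let hr , hs = to T-∧ h in _ , nullable⇒emptyMatch r hr , nullable⇒emptyMatch s hs
  nullable⇒emptyMatch (gstar r) _ = ε

  -- Prefix r q i j: w[i, j) is a prefix of an r-match whose last letter is read at position q.
  Prefix : (r : Guard n) → Position r → ℕ → ℕ → Set
  Prefix (gprop ψ) _ i j = TFMatch w (gprop ψ) i j
  Prefix (r +ᵍ s) (inj₁ p) i j = Prefix r p i j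
  Prefix (r +ᵍ s) (inj₂ q) i j = Prefix s q i j
  Prefix (r ·ᵍ s) (inj₁ p) i j = Prefix r p i j
  Prefix (r ·ᵍ s) (inj₂ q) i j = ∃ λ m → TFMatch w r i m × Prefix s q m j
  Prefix (gstar r) q i j = ∃ λ m → TFMatch w (gstar r) i m × Prefix r q m j

  Prefix⇒< : ∀ (r : Guard n) q {i j} → Prefix r q i j → i < j
  Prefix⇒< (gprop ψ) _ (refl , _) = ≤-refl
  Prefix⇒< (r +ᵍ s) (inj₁ p) h = Prefix⇒< r p h
  Prefix⇒< (r +ᵍ s) (inj₂ q) h = Prefix⇒< s q h
  Prefix⇒< (r ·ᵍ s) (inj₁ p) h = Prefix⇒< r p h
  Prefix⇒< (r ·ᵍ s) (inj₂ q) (m , x , h) = ≤-trans (s≤s (TFMatch⇒≤ w r x)) (Prefix⇒< s q h)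
  Prefix⇒< (gstar r) q (m , x , h) = ≤-trans (s≤s (TFMatch⇒≤ w (gstar r) x)) (Prefix⇒< r q h)

  NonEmptyMatch : Guard n → ℕ → ℕ → Set
  NonEmptyMatch r i j = ∃ λ q → Member r (last r) q × Prefix r q i j

  match⇒empty⊎nonEmpty : ∀ (r : Guard n) {i j} →
                         TFMatch w r i j → j ≡ i ⊎ NonEmptyMatch r i j
  match⇒empty⊎nonEmpty (gprop ψ) x = inj₂ (tt , tt , x)
  match⇒empty⊎nonEmpty (r +ᵍ s) (inj₁ x) with match⇒empty⊎nonEmpty r x
  ... | inj₁ e = inj₁ e
  ... | inj₂ (p , l , h) = inj₂ (inj₁ p , l , h)
  match⇒empty⊎nonEmpty (r +ᵍ s) (inj₂ y) with match⇒empty⊎nonEmpty s y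
  ... | inj₁ e = inj₁ e
  ... | inj₂ (q , l , h) = inj₂ (inj₂ q , l , h)
  match⇒empty⊎nonEmpty (r ·ᵍ s) (m , x , y) with match⇒empty⊎nonEmpty s y
  ... | inj₂ (q , l , h) = inj₂ (inj₂ q , l , m , x , h)
  ... | inj₁ refl with match⇒empty⊎nonEmpty r x
  ...   | inj₁ e = inj₁ e
  ...   | inj₂ (p , l , h) =
            let l′ = from (∈-when r (nullable s) (last r) p) (emptyMatch⇒nullable s y ≤-refl , l)
            in inj₂ (inj₁ p , l′ , h)
  match⇒empty⊎nonEmpty (gstar r) ε = inj₁ refl
  match⇒empty⊎nonEmpty (gstar r) (x ◅ xs) with match⇒empty⊎nonEmpty (gstar r) xs
  ... | inj₂ (q , l , m , xs′ , h) = inj₂ (q , l , m , x ◅ xs′ , h)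
  ... | inj₁ refl with match⇒empty⊎nonEmpty r x
  ...   | inj₁ e = inj₁ e
  ...   | inj₂ (q , l , h) = inj₂ (q , l , _ , ε , h)

  nonEmpty⇒match : ∀ (r : Guard n) {i j} → NonEmptyMatch r i j → TFMatch w r i j
  nonEmpty⇒match (gprop ψ) (_ , _ , h) = h
  nonEmpty⇒match (r +ᵍ s) (inj₁ p , l , h) = inj₁ (nonEmpty⇒match r (p , l , h))
  nonEmpty⇒match (r +ᵍ s) (inj₂ q , l , h) = inj₂ (nonEmpty⇒match s (q , l , h))
  nonEmpty⇒match (r ·ᵍ s) (inj₁ p , l , h) =
    let hs , l′ = to (∈-when r (nullable s) (last r) p) l
    in _ , nonEmpty⇒match r (p , l′ , h) , nullable⇒emptyMatch s hs
  nonEmpty⇒match (r ·ᵍ s) (inj₂ q , l , m , x , h) = m , x , nonEmpty⇒match s (q , l , h)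
  nonEmpty⇒match (gstar r) (q , l , m , xs , h) = xs ◅◅ (nonEmpty⇒match r (q , l , h) ◅ ε)

  match⇔ : ∀ (r : Guard n) {i j} →
           TFMatch w r i j ⇔ ((j ≡ i × T (nullable r)) ⊎ NonEmptyMatch r i j)
  match⇔ r = mk⇔ to′ from′
    where
    to′ : ∀ {i j} → TFMatch w r i j → (j ≡ i × T (nullable r)) ⊎ NonEmptyMatch r i j
    to′ x with match⇒empty⊎nonEmpty r x
    ... | inj₁ refl = inj₁ (refl , emptyMatch⇒nullable r x ≤-refl)
    ... | inj₂ h = inj₂ h
    from′ : ∀ {i j} → (j ≡ i × T (nullable r)) ⊎ NonEmptyMatch r i j → TFMatch w r i j
    from′ (inj₁ (refl , h)) = nullable⇒emptyMatch r h
    from′ (inj₂ h) = nonEmpty⇒match r h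

  Extends : (r : Guard n) → Position r → ℕ → ℕ → Set
  Extends r q i j =
    T (evalP (w j) (label r q)) ×
    ((j ≡ i × Member r (first r) q) ⊎ ∃ λ p → Prefix r p i j × Follows r p q)

  Prefix-step : ∀ (r : Guard n) q {i j} → Prefix r q i (suc j) ⇔ Extends r q i j
  Prefix-step (gprop ψ) _ =
    mk⇔ (λ { (refl , h) → h , inj₁ (refl , tt) }) λ { (h , inj₁ (refl , _)) → refl , h }
  Prefix-step (r +ᵍ s) (inj₁ q) = mk⇔
    (Product.map₂ (Sum.map₂ λ (p , y , f) → inj₁ p , y , f) ∘ to (Prefix-step r q))
    (λ { (a , inj₁ e) → from (Prefix-step r q) (a , inj₁ e)
       ; (a , inj₂ (inj₁ p , y , f)) → from (Prefix-step r q) (a , inj₂ (p , y , f)) })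
  Prefix-step (r +ᵍ s) (inj₂ q) = mk⇔
    (Product.map₂ (Sum.map₂ λ (p , y , f) → inj₂ p , y , f) ∘ to (Prefix-step s q))
    (λ { (a , inj₁ e) → from (Prefix-step s q) (a , inj₁ e)
       ; (a , inj₂ (inj₂ p , y , f)) → from (Prefix-step s q) (a , inj₂ (p , y , f)) })
  Prefix-step (r ·ᵍ s) (inj₁ q) = mk⇔
    (Product.map₂ (Sum.map₂ λ (p , y , f) → inj₁ p , y , f) ∘ to (Prefix-step r q))
    (λ { (a , inj₁ e) → from (Prefix-step r q) (a , inj₁ e)
       ; (a , inj₂ (inj₁ p , y , f)) → from (Prefix-step r q) (a , inj₂ (p , y , f)) })
  Prefix-step (r ·ᵍ s) (inj₂ q) = mk⇔ to′ from′
    where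
    first-s : Member s (when s (nullable r) (first s)) q ⇔ (T (nullable r) × Member s (first s) q)
    first-s = ∈-when s (nullable r) (first s) q
    to′ : ∀ {i j} → Prefix (r ·ᵍ s) (inj₂ q) i (suc j) → Extends (r ·ᵍ s) (inj₂ q) i j
    to′ (m , x , h) with to (Prefix-step s q) h
    ... | a , inj₂ (p , y , f) = a , inj₂ (inj₂ p , (m , x , y) , f)
    ... | a , inj₁ (refl , f) with match⇒empty⊎nonEmpty r x
    ...   | inj₁ refl = a , inj₁ (refl , from first-s (emptyMatch⇒nullable r x ≤-refl , f))
    ...   | inj₂ (p , l , y) = a , inj₂ (inj₁ p , y , l , f)
    from′ : ∀ {i j} → Extends (r ·ᵍ s) (inj₂ q) i j → Prefix (r ·ᵍ s) (inj₂ q) i (suc j)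
    from′ (a , inj₁ (refl , f)) =
      let hr , f′ = to first-s f
      in _ , nullable⇒emptyMatch r hr , from (Prefix-step s q) (a , inj₁ (refl , f′))
    from′ (a , inj₂ (inj₁ p , y , l , f)) =
      _ , nonEmpty⇒match r (p , l , y) , from (Prefix-step s q) (a , inj₁ (refl , f))
    from′ (a , inj₂ (inj₂ p , (m , x , y) , f)) =
      m , x , from (Prefix-step s q) (a , inj₂ (p , y , f))
  Prefix-step (gstar r) q = mk⇔ to′ from′
    where
    to′ : ∀ {i j} → Prefix (gstar r) q i (suc j) → Extends (gstar r) q i j
    to′ (m , xs , h) with to (Prefix-step r q) h
    ... | a , inj₂ (p , y , f) = a , inj₂ (p , (m , xs , y) , inj₁ f)
    ... | a , inj₁ (refl , f) with match⇒empty⊎nonEmpty (gstar r) xs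
    ...   | inj₁ refl = a , inj₁ (refl , f)
    ...   | inj₂ (p , l , y) = a , inj₂ (p , y , inj₂ (l , f))
    from′ : ∀ {i j} → Extends (gstar r) q i j → Prefix (gstar r) q i (suc j)
    from′ (a , inj₁ (refl , f)) = _ , ε , from (Prefix-step r q) (a , inj₁ (refl , f))
    from′ (a , inj₂ (p , (m , xs , y) , inj₁ f)) =
      m , xs , from (Prefix-step r q) (a , inj₂ (p , y , f))
    from′ (a , inj₂ (p , y , inj₂ (l , f))) =
      _ , nonEmpty⇒match (gstar r) (p , l , y) , from (Prefix-step r q) (a , inj₁ (refl , f))

-- Deterministic automata

record DFA (n : ℕ) : Set₁ where
  field
    State : Set
    states : List State
    ∈-states : ∀ q → q ∈ states
    start : State
    step : State → Subset n → State
    accepting : State → Bool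
    edge : State → State → PropF n
    edge-sound : ∀ x p q → T (evalP x (edge p q)) → step p x ≡ q
    edge-complete : ∀ x p → T (evalP x (edge p (step p x)))

  run : ∀ (w : Trace n) → State → ℕ → ℕ → State
  run w p i zero = p
  run w p i (suc d) = run w (step p (w i)) (suc i) d

  run-+ : ∀ w p i d e → run w p i (d + e) ≡ run w (run w p i d) (i + d) e
  run-+ w p i zero e rewrite +-identityʳ i = refl
  run-+ w p i (suc d) e rewrite +-suc i d = run-+ w (step p (w i)) (suc i) d e

  run-snoc : ∀ w p i d → run w p i (suc d) ≡ step (run w p i d) (w (i + d))
  run-snoc w p i zero rewrite +-identityʳ i = refl
  run-snoc w p i (suc d) rewrite +-suc i d = run-snoc w (step p (w i)) (suc i) d

  Recognises : Guard n → Set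
  Recognises r = ∀ w i d → T (accepting (run w start i d)) ⇔ TFMatch w r i (i + d)

module GlushkovAutomaton {n : ℕ} (r : Guard n) where
  open Glushkov

  -- The flag is set exactly before the first letter has been read.
  State : Set
  State = Bool × PositionSet r

  successorsOf : State → PositionSet r
  successorsOf (b , X) = union r (successors r X) (when r b (first r))

  ∈-successorsOf : ∀ b X q →
    Member r (successorsOf (b , X)) q ⇔
    ((T b × Member r (first r) q) ⊎ ∃ λ p → Member r X p × Follows r p q)
  ∈-successorsOf b X q =
    mk⇔ Sum.swap Sum.swap ⇔-∘
    ((∈-successors r X q ⊎-⇔ ∈-when r b (first r) q) ⇔-∘ ∈-union r _ _ q)

  step : State → Subset n → State
  step q x = false , restrict r (successorsOf q) x

  edge : State → State → PropF n
  edge p (true , _) = ⊥ᵖ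
  edge p (false , Y) = restrictsTo r (successorsOf p) Y

  automaton : DFA n
  automaton = record
    { State = State
    ; states = cartesianProduct (true ∷ false ∷ []) (positionSets r)
    ; ∈-states = λ where
        (true , X) → ∈-cartesianProduct⁺ {xs = true ∷ false ∷ []} (here refl) (∈-positionSets r X)
        (false , X) →
          ∈-cartesianProduct⁺ {xs = true ∷ false ∷ []} (there (here refl)) (∈-positionSets r X)
    ; start = true , empty r
    ; step = step
    ; accepting = λ (b , X) → (b ∧ nullable r) ∨ meets r X (last r)
    ; edge = edge
    ; edge-sound = λ where
        x p (true , _) ()
        x p (false , Y) h → cong (false ,_) (to (restrictsTo⇔ r (successorsOf p) Y x) h)
    ; edge-complete = λ x p → from (restrictsTo⇔ r (successorsOf p) _ x) refl
    }

  open DFA automaton using (run; run-snoc; start; accepting; Recognises)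

  module _ (w : Trace n) where
    open GlushkovMatching w

    atStart⇔ : ∀ i d → T (proj₁ (run w start i d)) ⇔ (i + d ≡ i)
    atStart⇔ i zero = mk⇔ (λ _ → +-identityʳ i) (λ _ → tt)
    atStart⇔ i (suc d) rewrite run-snoc w start i d = mk⇔ (λ ()) (λ e → ⊥-elim (m+1+n≢m i e))

    marked⇔Prefix : ∀ i d q → Member r (proj₂ (run w start i d)) q ⇔ Prefix r q i (i + d)
    marked⇔Prefix i zero q rewrite +-identityʳ i =
      mk⇔ (⊥-elim ∘ ∉-empty r q) (λ h → ⊥-elim (<-irrefl refl (Prefix⇒< r q h)))
    marked⇔Prefix i (suc d) q rewrite run-snoc w start i d | +-suc i d =
      ⇔-sym (Prefix-step r q) ⇔-∘
      (mk⇔ to′ from′ ⇔-∘ ∈-restrict r (successorsOf (b , X)) (w (i + d)) q)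
      where
      b : Bool
      b = proj₁ (run w start i d)
      X : PositionSet r
      X = proj₂ (run w start i d)
      to′ : Member r (successorsOf (b , X)) q × T (evalP (w (i + d)) (label r q)) →
            Extends r q i (i + d)
      to′ (h , a) = a , Sum.map (Product.map₁ (to (atStart⇔ i d)))
                                (λ (p , x , f) → p , to (marked⇔Prefix i d p) x , f)
                                (to (∈-successorsOf b X q) h)
      from′ : Extends r q i (i + d) →
              Member r (successorsOf (b , X)) q × T (evalP (w (i + d)) (label r q))
      from′ (a , e) = from (∈-successorsOf b X q)
                        (Sum.map (Product.map₁ (from (atStart⇔ i d)))
                                 (λ (p , y , f) → p , from (marked⇔Prefix i d p) y , f) e) , a

  recognises : Recognises r
  recognises w i d = mk⇔ to′ from′ ⇔-∘ ((T-∧ ⊎-⇔ meets⇔ r X (last r)) ⇔-∘ T-∨)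
    where
    open GlushkovMatching w
    b : Bool
    b = proj₁ (run w start i d)
    X : PositionSet r
    X = proj₂ (run w start i d)
    to′ : (T b × T (nullable r)) ⊎ (∃ λ q → Member r X q × Member r (last r) q) →
          TFMatch w r i (i + d)
    to′ (inj₁ (a , ν)) = from (match⇔ r) (inj₁ (to (atStart⇔ w i d) a , ν))
    to′ (inj₂ (q , x , l)) = from (match⇔ r) (inj₂ (q , l , to (marked⇔Prefix w i d q) x))
    from′ : TFMatch w r i (i + d) →
            (T b × T (nullable r)) ⊎ (∃ λ q → Member r X q × Member r (last r) q)
    from′ m with to (match⇔ r) m
    ... | inj₁ (e , ν) = inj₁ (from (atStart⇔ w i d) e , ν)
    ... | inj₂ (q , l , h) = inj₂ (q , from (marked⇔Prefix w i d q) h , l)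

-- Kleene's construction and prefix classes

⋁ : ∀ {n} {A : Set} → (A → Form n) → A → List A → Form n
⋁ F x [] = F x
⋁ F x (y ∷ ys) = F x ∨ᶠ ⋁ F y ys

⋀ : ∀ {n} {A : Set} → (A → Form n) → A → List A → Form n
⋀ F x [] = F x
⋀ F x (y ∷ ys) = F x ∧ᶠ ⋀ F y ys

module _ {n : ℕ} (w : Trace n) (k : ℕ) where

  ⋁⇔ : ∀ {A : Set} (F : A → Form n) {x xs} → (∀ q → q ∈ x ∷ xs) → ∀ {i} →
       PHolds w k (⋁ F x xs) i ⇔ ∃ λ q → PHolds w k (F q) i
  ⋁⇔ F {x} {xs} complete = mk⇔ (elim x xs) (λ (q , h) → intro x xs (complete q) h)
    where
    elim : ∀ x xs {i} → PHolds w k (⋁ F x xs) i → ∃ λ q → PHolds w k (F q) i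
    elim x [] h = x , h
    elim x (y ∷ ys) (inj₁ h) = x , h
    elim x (y ∷ ys) (inj₂ h) = elim y ys h
    intro : ∀ x xs {q i} → q ∈ x ∷ xs → PHolds w k (F q) i → PHolds w k (⋁ F x xs) i
    intro x [] (here refl) h = h
    intro x (y ∷ ys) (here refl) h = inj₁ h
    intro x (y ∷ ys) (there q∈) h = inj₂ (intro y ys q∈ h)

  ⋀⇔ : ∀ {A : Set} (F : A → Form n) {x xs} → (∀ q → q ∈ x ∷ xs) → ∀ {i} →
       PHolds w k (⋀ F x xs) i ⇔ ∀ q → PHolds w k (F q) i
  ⋀⇔ F {x} {xs} complete = mk⇔ (λ h q → elim x xs (complete q) h) (intro x xs)
    where
    elim : ∀ x xs {q i} → q ∈ x ∷ xs → PHolds w k (⋀ F x xs) i → PHolds w k (F q) i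
    elim x [] (here refl) h = h
    elim x (y ∷ ys) (here refl) (h , _) = h
    elim x (y ∷ ys) (there q∈) (_ , h) = elim y ys q∈ h
    intro : ∀ x xs {i} → (∀ q → PHolds w k (F q) i) → PHolds w k (⋀ F x xs) i
    intro x [] h = h x
    intro x (y ∷ ys) h = h x , intro y ys h

module Kleene {n : ℕ} (A : DFA n) where
  open DFA A

  -- paths xs p q matches the nonempty runs from p to q whose intermediate states lie in xs.
  paths : List State → State → State → Guard n
  paths [] p q = gprop (edge p q)
  paths (x ∷ xs) p q = paths xs p q +ᵍ ((paths xs p x ·ᵍ gstar (paths xs x x)) ·ᵍ paths xs x q)

  paths-testFree : ∀ xs p q → TestFreeG (paths xs p q)
  paths-testFree [] p q = tt
  paths-testFree (x ∷ xs) p q =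
    paths-testFree xs p q , (paths-testFree xs p x , paths-testFree xs x x) , paths-testFree xs x q

  module _ (w : Trace n) where

    data Path (P : State → Set) : State → ℕ → State → ℕ → Set where
      one : ∀ {p i} → Path P p i (step p (w i)) (suc i)
      more : ∀ {p i q j} → P (step p (w i)) → Path P (step p (w i)) (suc i) q j → Path P p i q j

    Loops : (P : State → Set) → State → ℕ → ℕ → Set
    Loops P x = Star (λ a b → Path P x a x b)

    ThroughOnce : State → List State → State → ℕ → State → ℕ → Set
    ThroughOnce x xs p i q j =
      ∃ λ a → ∃ λ b → Path (_∈ xs) p i x a × Loops (_∈ xs) x a b × Path (_∈ xs) x b q j

    split-at : ∀ {x xs p i q j} →
               Path (_∈ x ∷ xs) p i q j → Path (_∈ xs) p i q j ⊎ ThroughOnce x xs p i q j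
    split-at one = inj₁ one
    split-at {i = i} (more (here refl) rest) with split-at rest
    ... | inj₁ rest′ = inj₂ (suc i , suc i , one , ε , rest′)
    ... | inj₂ (a , b , to-x , loops , from-x) = inj₂ (suc i , b , one , to-x ◅ loops , from-x)
    split-at (more (there h) rest) with split-at rest
    ... | inj₁ rest′ = inj₁ (more h rest′)
    ... | inj₂ (a , b , to-x , loops , from-x) = inj₂ (a , b , more h to-x , loops , from-x)

    Path⇒paths : ∀ xs {p i q j} → Path (_∈ xs) p i q j → TFMatch w (paths xs p q) i j
    Path⇒paths [] one = refl , edge-complete (w _) _
    Path⇒paths (x ∷ xs) π with split-at π
    ... | inj₁ π′ = inj₁ (Path⇒paths xs π′)
    ... | inj₂ (a , b , to-x , loops , from-x) =
          inj₂ (b , (a , Path⇒paths xs to-x , Star-map (Path⇒paths xs) loops) , Path⇒paths xs from-x)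

    Walk : State → ℕ → State → ℕ → Set
    Walk = Path (λ _ → ⊤)

    _++ʷ_ : ∀ {p i q j s k} → Walk p i q j → Walk q j s k → Walk p i s k
    one ++ʷ ρ = more tt ρ
    more _ π ++ʷ ρ = more tt (π ++ʷ ρ)

    paths⇒Walk : ∀ xs {p i q j} → TFMatch w (paths xs p q) i j → Walk p i q j
    paths⇒Walk [] {p} {i} {q} (refl , h) with edge-sound (w i) p q h
    ... | refl = one
    paths⇒Walk (x ∷ xs) (inj₁ π) = paths⇒Walk xs π
    paths⇒Walk (x ∷ xs) (inj₂ (_ , (_ , to-x , loops) , from-x)) =
      around (paths⇒Walk xs to-x) loops ++ʷ paths⇒Walk xs from-x
      where
      around : ∀ {p i a b} → Walk p i x a → Star (TFMatch w (paths xs x x)) a b → Walk p i x b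
      around π ε = π
      around π (ℓ ◅ ℓs) = around (π ++ʷ paths⇒Walk xs ℓ) ℓs

    Path⇒run : ∀ {P p i q j} → Path P p i q j → ∃ λ d → j ≡ i + suc d × run w p i (suc d) ≡ q
    Path⇒run {i = i} one = zero , sym (+-comm i 1) , refl
    Path⇒run {i = i} (more _ π) with Path⇒run π
    ... | d , refl , e = suc d , sym (+-suc i (suc d)) , e

    run⇒Path : ∀ p i d → Path (_∈ states) p i (run w p i (suc d)) (i + suc d)
    run⇒Path p i zero rewrite +-comm i 1 = one
    run⇒Path p i (suc d) rewrite +-suc i (suc d) =
      more (∈-states _) (run⇒Path (step p (w i)) (suc i) d)

  reach : State → Guard n
  reach q = paths states start q

  reach-testFree : ∀ q → TestFreeG (reach q)
  reach-testFree = paths-testFree states start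

  acceptingFrom : State → List State → Guard n
  acceptingFrom q [] = ∅ᵍ
  acceptingFrom q (q′ ∷ qs) = (paths states q q′ onlyIf accepting q′) +ᵍ acceptingFrom q qs

  toAccepting : State → Guard n
  toAccepting q = (εᵍ onlyIf accepting q) +ᵍ acceptingFrom q states

  toAccepting-testFree : ∀ q → TestFreeG (toAccepting q)
  toAccepting-testFree q = onlyIf-testFree (accepting q) tt , acceptingFrom-testFree states
    where
    acceptingFrom-testFree : ∀ qs → TestFreeG (acceptingFrom q qs)
    acceptingFrom-testFree [] = tt
    acceptingFrom-testFree (q′ ∷ qs) =
      onlyIf-testFree (accepting q′) (paths-testFree states q q′) , acceptingFrom-testFree qs

  almostAllᶠ : Form n → Form n
  almostAllᶠ ψ = ⋁ (λ q → dia (reach q) (box (toAccepting q) ψ)) start states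

  infinitelyManyᶠ : Form n → Form n
  infinitelyManyᶠ ψ = ⋀ (λ q → box (reach q) (dia (toAccepting q) ψ)) start states

  module _ (w : Trace n) where

    reach⇔ : ∀ {q i m} →
             TFMatch w (reach q) i m ⇔ ∃ λ d → m ≡ i + suc d × run w start i (suc d) ≡ q
    reach⇔ = mk⇔ (Path⇒run w ∘ paths⇒Walk w states)
                 λ { (d , refl , refl) → Path⇒paths w states (run⇒Path w start _ d) }

    acceptingFrom⇔ : ∀ {q i j} qs →
      TFMatch w (acceptingFrom q qs) i j ⇔
      ∃ λ q′ → q′ ∈ qs × T (accepting q′) × TFMatch w (paths states q q′) i j
    acceptingFrom⇔ {q} [] = mk⇔ (λ ()) λ ()
    acceptingFrom⇔ {q} (q′ ∷ qs) = mk⇔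
      (λ { (inj₁ x) → let a , π = to (onlyIf⇔ w _ (accepting q′)) x in q′ , here refl , a , π
         ; (inj₂ y) → let q″ , m , a , π = to (acceptingFrom⇔ qs) y in q″ , there m , a , π })
      (λ { (_ , here refl , a , π) → inj₁ (from (onlyIf⇔ w _ (accepting q′)) (a , π))
         ; (q″ , there m , a , π) → inj₂ (from (acceptingFrom⇔ qs) (q″ , m , a , π)) })

    toAccepting⇔ : ∀ {q m j} →
      TFMatch w (toAccepting q) m j ⇔ ∃ λ d → j ≡ m + d × T (accepting (run w q m d))
    toAccepting⇔ {q} {m} = mk⇔ to′ from′
      where
      to′ : ∀ {j} → TFMatch w (toAccepting q) m j → ∃ λ d → j ≡ m + d × T (accepting (run w q m d))
      to′ (inj₁ x) with to (onlyIf⇔ w εᵍ (accepting q)) x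
      ... | a , ε = 0 , sym (+-identityʳ m) , a
      to′ (inj₂ y) with to (acceptingFrom⇔ states) y
      ... | q′ , _ , a , π with Path⇒run w (paths⇒Walk w states π)
      ...   | d , refl , refl = suc d , refl , a
      from′ : ∀ {j} → (∃ λ d → j ≡ m + d × T (accepting (run w q m d))) →
              TFMatch w (toAccepting q) m j
      from′ (zero , refl , a) rewrite +-identityʳ m =
        inj₁ (from (onlyIf⇔ w εᵍ (accepting q)) (a , ε))
      from′ (suc d , refl , a) = inj₂ (from (acceptingFrom⇔ states)
        (_ , ∈-states _ , a , Path⇒paths w states (run⇒Path w q m d)))

module PrefixClasses {n : ℕ} (A : DFA n) {r : Guard n} (A-recognises-r : DFA.Recognises A r)
                     (w : Trace n) (k : ℕ) where
  open DFA A
  open Kleene A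

  accepting-after : ∀ i d f →
    T (accepting (run w (run w start i d) (i + d) f)) ⇔ TFMatch w r i (i + d + f)
  accepting-after i d f rewrite sym (run-+ w start i d f) | +-assoc i d f =
    A-recognises-r w i (d + f)

  reach-total : ∀ {i m} → i < m → ∃ λ q → TFMatch w (reach q) i m
  reach-total {i} i<m with m≤n⇒∃[o]m+o≡n i<m
  ... | d , refl = run w start i (suc d) , from (reach⇔ w) (d , sym (+-suc i d) , refl)

  reach-toAccepting⇒match : ∀ {q i m j} →
    TFMatch w (reach q) i m → TFMatch w (toAccepting q) m j → TFMatch w r i j
  reach-toAccepting⇒match {i = i} x y with to (reach⇔ w) x
  ... | d , refl , refl with to (toAccepting⇔ w) y
  ...   | f , refl , a = to (accepting-after i (suc d) f) a

  reach-match⇒toAccepting : ∀ {q i m j} →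
    TFMatch w (reach q) i m → TFMatch w r i j → m ≤ j → TFMatch w (toAccepting q) m j
  reach-match⇒toAccepting {i = i} x y m≤j with to (reach⇔ w) x | m≤n⇒∃[o]m+o≡n m≤j
  ... | d , refl , refl | f , refl =
        from (toAccepting⇔ w) (f , refl , from (accepting-after i (suc d) f) y)

  almostAll⇔ : ∀ {i} (P : ℕ → Set) →
    (∃ λ m → ∀ j → m ≤ j → TFMatch w r i j → P j) ⇔
    (∃ λ q → ∃ λ m → TFMatch w (reach q) i m × ∀ j → TFMatch w (toAccepting q) m j → P j)
  -- reach q only matches nonempty words, whence the cut point m₀ ⊔ suc i.
  almostAll⇔ {i} P = mk⇔
    (λ (m₀ , h) → let q , x = reach-total (m≤n⊔m m₀ (suc i)) in
       q , m₀ ⊔ suc i , x , λ j y →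
         h j (≤-trans (m≤m⊔n m₀ (suc i)) (TFMatch⇒≤ w (toAccepting q) y))
             (reach-toAccepting⇒match x y))
    (λ (q , m , x , h) → m , λ j m≤j y → h j (reach-match⇒toAccepting x y m≤j))

  infinitelyMany⇔ : ∀ {i} (P : ℕ → Set) →
    (∀ m → ∃ λ j → m ≤ j × TFMatch w r i j × P j) ⇔
    (∀ q m → TFMatch w (reach q) i m → ∃ λ j → TFMatch w (toAccepting q) m j × P j)
  infinitelyMany⇔ {i} P = mk⇔ to′ from′
    where
    to′ : (∀ m → ∃ λ j → m ≤ j × TFMatch w r i j × P j) →
          ∀ q m → TFMatch w (reach q) i m → ∃ λ j → TFMatch w (toAccepting q) m j × P j
    to′ h q m x = let j , m≤j , y , p = h m in j , reach-match⇒toAccepting x y m≤j , p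
    from′ : (∀ q m → TFMatch w (reach q) i m → ∃ λ j → TFMatch w (toAccepting q) m j × P j) →
            ∀ m → ∃ λ j → m ≤ j × TFMatch w r i j × P j
    from′ h m₀ = let q , x = reach-total (m≤n⊔m m₀ (suc i))
                     j , y , p = h q (m₀ ⊔ suc i) x
                 in j , ≤-trans (m≤m⊔n m₀ (suc i)) (TFMatch⇒≤ w (toAccepting q) y) ,
                    reach-toAccepting⇒match x y , p

  reach⇔ᴾ : ∀ q {a b} → PMatch w k (reach q) a b ⇔ TFMatch w (reach q) a b
  reach⇔ᴾ q = PMatch⇔TFMatch w k (reach q) (reach-testFree q)

  toAccepting⇔ᴾ : ∀ q {a b} → PMatch w k (toAccepting q) a b ⇔ TFMatch w (toAccepting q) a b
  toAccepting⇔ᴾ q = PMatch⇔TFMatch w k (toAccepting q) (toAccepting-testFree q)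

  almostAll⇔ᶠ : ∀ {i} ψ →
    BoxInf (suc zero) (TFMatch w r i) (PHolds w k ψ) ⇔ PHolds w k (almostAllᶠ ψ) i
  almostAll⇔ᶠ {i} ψ =
    ⇔-sym (⋁⇔ w k _ (there ∘ ∈-states)) ⇔-∘ (mk⇔ to′ from′ ⇔-∘ almostAll⇔ (PHolds w k ψ))
    where
    to′ : (∃ λ q → ∃ λ m → TFMatch w (reach q) i m ×
                            ∀ j → TFMatch w (toAccepting q) m j → PHolds w k ψ j) →
          ∃ λ q → PHolds w k (dia (reach q) (box (toAccepting q) ψ)) i
    to′ (q , m , x , h) = q , m , from (reach⇔ᴾ q) x , λ j y → h j (to (toAccepting⇔ᴾ q) y)
    from′ : (∃ λ q → PHolds w k (dia (reach q) (box (toAccepting q) ψ)) i) →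
            ∃ λ q → ∃ λ m → TFMatch w (reach q) i m ×
                             ∀ j → TFMatch w (toAccepting q) m j → PHolds w k ψ j
    from′ (q , m , x , h) = q , m , to (reach⇔ᴾ q) x , λ j y → h j (from (toAccepting⇔ᴾ q) y)

  infinitelyMany⇔ᶠ : ∀ {i} ψ →
    BoxInf (suc (suc zero)) (TFMatch w r i) (PHolds w k ψ) ⇔ PHolds w k (infinitelyManyᶠ ψ) i
  infinitelyMany⇔ᶠ {i} ψ =
    ⇔-sym (⋀⇔ w k _ (there ∘ ∈-states)) ⇔-∘ (mk⇔ to′ from′ ⇔-∘ infinitelyMany⇔ (PHolds w k ψ))
    where
    to′ : (∀ q m → TFMatch w (reach q) i m →
                   ∃ λ j → TFMatch w (toAccepting q) m j × PHolds w k ψ j) →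
          ∀ q → PHolds w k (box (reach q) (dia (toAccepting q) ψ)) i
    to′ h q m x = let j , y , p = h q m (to (reach⇔ᴾ q) x) in j , from (toAccepting⇔ᴾ q) y , p
    from′ : (∀ q → PHolds w k (box (reach q) (dia (toAccepting q) ψ)) i) →
            ∀ q m → TFMatch w (reach q) i m →
                    ∃ λ j → TFMatch w (toAccepting q) m j × PHolds w k ψ j
    from′ h q m x = let j , y , p = h q m (from (reach⇔ᴾ q) x) in j , to (toAccepting⇔ᴾ q) y , p

-- The translation

infinite⇒¬finite : ∀ {M : ℕ → Set} → Infinite M → ¬ Finite M
infinite⇒¬finite inf (b , bound) = let j , b≤j , x = inf b in ≤⇒≯ b≤j (bound j x)

box⇔BoxInf : ∀ {M : ℕ → Set} {B C : Set} → Infinite M → ((Infinite M → B) × (Finite M → C)) ⇔ B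
box⇔BoxInf inf = mk⇔ (λ (h , _) → h inf) (λ b → (λ _ → b) , ⊥-elim ∘ infinite⇒¬finite inf)

BoxInf-cong : ∀ ℓ {M M′ S S′ : ℕ → Set} → (∀ {j} → M j ⇔ M′ j) → (∀ {j} → S j ⇔ S′ j) →
              BoxInf ℓ M S ⇔ BoxInf ℓ M′ S′
BoxInf-cong zero M⇔ S⇔ =
  mk⇔ (λ h j x → to S⇔ (h j (from M⇔ x))) (λ h j x → from S⇔ (h j (to M⇔ x)))
BoxInf-cong (suc zero) M⇔ S⇔ =
  mk⇔ (λ (m , h) → m , λ j m≤j x → to S⇔ (h j m≤j (from M⇔ x)))
      (λ (m , h) → m , λ j m≤j x → from S⇔ (h j m≤j (to M⇔ x)))
BoxInf-cong (suc (suc zero)) M⇔ S⇔ =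
  mk⇔ (λ h → Product.map₂ (Product.map₂ (Product.map (to M⇔) (to S⇔))) ∘ h)
      (λ h → Product.map₂ (Product.map₂ (Product.map (from M⇔) (from S⇔))) ∘ h)
BoxInf-cong (suc (suc (suc zero))) M⇔ S⇔ =
  mk⇔ (λ (j , x , s) → j , to M⇔ x , to S⇔ s) (λ (j , x , s) → j , from M⇔ x , from S⇔ s)

translateBox : ∀ {n} → Fin 4 → Guard n → Form n → Form n
translateBox zero r ψ = box r ψ
translateBox (suc zero) r ψ = Kleene.almostAllᶠ (GlushkovAutomaton.automaton r) ψ
translateBox (suc (suc zero)) r ψ = Kleene.infinitelyManyᶠ (GlushkovAutomaton.automaton r) ψ
translateBox (suc (suc (suc zero))) r ψ = dia r ψ

translate : ∀ {n} → Fin 4 → Form n → Form n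
translate ℓ (atom p) = atom p
translate ℓ (natom p) = natom p
translate ℓ (φ ∧ᶠ ψ) = translate ℓ φ ∧ᶠ translate ℓ ψ
translate ℓ (φ ∨ᶠ ψ) = translate ℓ φ ∨ᶠ translate ℓ ψ
translate ℓ (dia r φ) = dia r (translate ℓ φ)
translate ℓ (pdia r φ) = pdia r (translate ℓ φ)
translate ℓ (box r φ) = translateBox ℓ r (translate ℓ φ)

-- [∅]ψ is vacuously true: Form has no constant ⊤, and for n = 0 not even an atom.
requireIf : ∀ {n} → Bool → Form n → Form n
requireIf b ψ = if b then ψ else box ∅ᵍ ψ

atLeast : ∀ {n} → 𝔹₄ → Form n → Form n
atLeast β φ =
  ⋀ (λ ℓ → requireIf (bit β ℓ) (translate ℓ φ)) zero (suc zero ∷ suc (suc zero) ∷ suc (suc (suc zero)) ∷ [])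

module _ {n : ℕ} (w : Trace n) (k : ℕ) where

  boxInf⇔translateBox : ∀ ℓ (r : Guard n) → TestFreeG r → ∀ ψ i →
    BoxInf ℓ (TFMatch w r i) (PHolds w k ψ) ⇔ PHolds w k (translateBox ℓ r ψ) i
  boxInf⇔translateBox zero r tf ψ i =
    mk⇔ (λ h j x → h j (to (PMatch⇔TFMatch w k r tf) x))
        (λ h j x → h j (from (PMatch⇔TFMatch w k r tf) x))
  boxInf⇔translateBox (suc zero) r _ ψ i =
    PrefixClasses.almostAll⇔ᶠ (GlushkovAutomaton.automaton r) (GlushkovAutomaton.recognises r) w k ψ
  boxInf⇔translateBox (suc (suc zero)) r _ ψ i =
    PrefixClasses.infinitelyMany⇔ᶠ (GlushkovAutomaton.automaton r) (GlushkovAutomaton.recognises r) w k ψ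
  boxInf⇔translateBox (suc (suc (suc zero))) r tf ψ i =
    mk⇔ (λ (j , x , s) → j , from (PMatch⇔TFMatch w k r tf) x , s)
        (λ (j , x , s) → j , to (PMatch⇔TFMatch w k r tf) x , s)

  translate-correct : ∀ ℓ (φ : Form n) → LimitMatching φ → ∀ i →
                      RHolds ℓ w k φ i ⇔ PHolds w k (translate ℓ φ) i
  translate-correct ℓ (atom p) _ i = ⇔-id _
  translate-correct ℓ (natom p) _ i = ⇔-id _
  translate-correct ℓ (φ ∧ᶠ ψ) (lm-φ , lm-ψ) i =
    translate-correct ℓ φ lm-φ i ×-⇔ translate-correct ℓ ψ lm-ψ i
  translate-correct ℓ (φ ∨ᶠ ψ) (lm-φ , lm-ψ) i =
    translate-correct ℓ φ lm-φ i ⊎-⇔ translate-correct ℓ ψ lm-ψ i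
  translate-correct ℓ (dia r φ) ((tf , _) , _ , lm-φ) i = mk⇔
    (λ (j , x , h) → j , to (RMatch⇔PMatch w k ℓ r tf) x , to (translate-correct ℓ φ lm-φ j) h)
    (λ (j , x , h) → j , from (RMatch⇔PMatch w k ℓ r tf) x , from (translate-correct ℓ φ lm-φ j) h)
  translate-correct ℓ (pdia r φ) ((tf , _) , _ , lm-φ) i = mk⇔
    (λ (j , j≤ , x , h) →
       j , j≤ , to (RMatch⇔PMatch w k ℓ r tf) x , to (translate-correct ℓ φ lm-φ j) h)
    (λ (j , j≤ , x , h) →
       j , j≤ , from (RMatch⇔PMatch w k ℓ r tf) x , from (translate-correct ℓ φ lm-φ j) h)
  translate-correct ℓ (box r φ) (lm-r@(tf , _) , _ , lm-φ) i =
    boxInf⇔translateBox ℓ r tf (translate ℓ φ) i ⇔-∘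
    (BoxInf-cong ℓ (RMatch⇔TFMatch w k ℓ r tf) (translate-correct ℓ φ lm-φ _) ⇔-∘ box⇔BoxInf infinite)
    where
    infinite : Infinite (RMatch ℓ w k r i)
    infinite m = let j , m≤j , x = limitMatching⇒infinite w lm-r i m
                 in j , m≤j , from (RMatch⇔TFMatch w k ℓ r tf) x

  requireIf⇔ : ∀ b ψ {i} → PHolds w k (requireIf b ψ) i ⇔ (T b → PHolds w k ψ i)
  requireIf⇔ true ψ = mk⇔ (λ h _ → h) (λ h → h tt)
  requireIf⇔ false ψ = mk⇔ (λ _ ()) (λ _ _ ())

  atLeast-correct : ∀ (φ : Form n) → LimitMatching φ → ∀ β → RGeq w k φ β ⇔ PSat w k (atLeast β φ)
  atLeast-correct φ lm β =
    ⇔-sym (⋀⇔ w k (λ ℓ → requireIf (bit β ℓ) (translate ℓ φ)) every-bit) ⇔-∘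
    mk⇔ (λ h ℓ → from (requireIf⇔ (bit β ℓ) (translate ℓ φ)) (to (translate-correct ℓ φ lm 0) ∘ h ℓ))
        (λ h ℓ → from (translate-correct ℓ φ lm 0) ∘ to (requireIf⇔ (bit β ℓ) (translate ℓ φ)) (h ℓ))
    where
    every-bit : ∀ ℓ → ℓ ∈ zero ∷ suc zero ∷ suc (suc zero) ∷ suc (suc (suc zero)) ∷ []
    every-bit zero = here refl
    every-bit (suc zero) = there (here refl)
    every-bit (suc (suc zero)) = there (there (here refl))
    every-bit (suc (suc (suc zero))) = there (there (there (here refl)))

-- Limit-matching guards are test-free by definition.
theorem8 : ∀ {n} (φ : Form n) → TestFree φ → LimitMatching φ → (β : 𝔹₄) →
    ∃ λ (φβ : Form n) → ∀ (w : Trace n) (k : ℕ) → RGeq w k φ β ⇔ PSat w k φβ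
theorem8 φ _ lm β = atLeast β φ , λ w k → atLeast-correct w k φ lm β
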